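{- For any nonnegative integers $N, r$, we have $$(-1)^N \le \sum_{k=0}^r (-2)^k \binom{N}{k}$$ when $r$ is even, and $$(-1)^N \ge \sum_{k=0}^r (-2)^k \binom{N}{k}$$ when $r$ is odd, using the convention that $\binom{N}{k}=0$ for $k>N$. -}

module Defs where

open import Data.Nat using (ℕ; zero; suc)
open import Data.Nat.Combinatorics using (_C_)
open import Data.Integer using (ℤ; +_; -_; _+_; _*_; _^_)

-- S N r = ∑_{k=0}^{r} (-2)^k * (N choose k)   (stdlib's N C k is 0 for k > N)
S : ℕ → ℕ → ℤ
S N zero    = (- + 2) ^ 0 * + (N C 0)
S N (suc r) = S N r + (- + 2) ^ suc r * + (N C suc r)

{-# OPTIONS --safe #-}
-- Write T(N, r) = ∑_{k≤r} (-2)^k C(N,k) and s = (-1)^N. Pascal's rule gives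
-- T(N+1, r+1) = T(N, r+1) - 2 T(N, r), while (-1)^(N+1) = s - 2 s. So if row N
-- alternates around s (T(N, r) ≥ s for even r, ≤ s for odd r), then row N+1
-- alternates around -s, with the parity of r preserved. Row 0 is constantly 1.
module Submission where

open import Defs
open import Function using (_∘_)
open import Data.Nat using (ℕ; zero; suc)
import Data.Nat as ℕ
open import Data.Nat.Combinatorics using (_C_; nCk+nC[k+1]≡[n+1]C[k+1])
open import Data.Nat.Divisibility using (_∣_; divides; _∣0; ∣-refl; ∣m∣n⇒∣m+n)
open import Data.Integer using (ℤ; +_; -_; _^_; _≤_; _+_; _*_; -≤+)
open import Data.Integer.Properties
  using (≤-refl; ≤-reflexive; +-mono-≤; neg-mono-≤; *-monoˡ-≤-nonPos; pos-+; *-zeroʳ; -1*i≡-i; module ≤-Reasoning)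
open import Data.Integer.Tactic.RingSolver using (solve-∀)
open import Data.Product using (_×_; _,_; proj₂; ∃-syntax)
open import Data.Empty using (⊥-elim)
open import Relation.Nullary using (¬_)
open import Relation.Binary.PropositionalEquality using (_≡_; refl; sym; trans; cong; cong₂; module ≡-Reasoning)

truncatedBinomial : ℤ → ℕ → ℕ → ℤ
truncatedBinomial x n zero    = x ^ 0 * + (n C 0)
truncatedBinomial x n (suc r) = truncatedBinomial x n r + x ^ suc r * + (n C suc r)

S≡truncatedBinomial : ∀ n r → S n r ≡ truncatedBinomial (- + 2) n r
S≡truncatedBinomial n zero    = refl
S≡truncatedBinomial n (suc r) = cong (_+ (- + 2) ^ suc r * + (n C suc r)) (S≡truncatedBinomial n r)

pascal-ℤ : ∀ n k → + (suc n C suc k) ≡ + (n C k) + + (n C suc k)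
pascal-ℤ n k = trans (cong +_ (sym (nCk+nC[k+1]≡[n+1]C[k+1] n k))) (pos-+ (n C k) (n C suc k))

truncatedBinomial-0 : ∀ x r → truncatedBinomial x 0 r ≡ + 1
truncatedBinomial-0 x zero    = refl
truncatedBinomial-0 x (suc r) = cong₂ _+_ (truncatedBinomial-0 x r) (*-zeroʳ (x ^ suc r))

truncatedBinomial-pascal : ∀ x n r →
  truncatedBinomial x (suc n) (suc r) ≡ truncatedBinomial x n (suc r) + x * truncatedBinomial x n r
truncatedBinomial-pascal x n zero =
  trans (cong (λ c → + 1 + x * + 1 * c) (pascal-ℤ n 0)) (rearrange x (+ (n C 1)))
  where
  rearrange : ∀ x c → + 1 + x * + 1 * (+ 1 + c) ≡ (+ 1 * + 1 + x * + 1 * c) + x * (+ 1 * + 1)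
  rearrange = solve-∀
truncatedBinomial-pascal x n (suc r) = begin
  T (suc n) (suc r) + x * p * + (suc n C suc (suc r))
    ≡⟨ cong₂ _+_ (truncatedBinomial-pascal x n r) (cong (x * p *_) (pascal-ℤ n (suc r))) ⟩
  (T n (suc r) + x * T n r) + x * p * (+ (n C suc r) + + (n C suc (suc r)))
    ≡⟨ rearrange (T n (suc r)) (T n r) x p (+ (n C suc r)) (+ (n C suc (suc r))) ⟩
  (T n (suc r) + x * p * + (n C suc (suc r))) + x * (T n r + p * + (n C suc r)) ∎
  where
  open ≡-Reasoning
  T : ℕ → ℕ → ℤ
  T = truncatedBinomial x
  p : ℤ
  p = x ^ suc r
  rearrange : ∀ A B x p c₁ c₂ →
    (A + x * B) + x * p * (c₁ + c₂) ≡ (A + x * p * c₂) + x * (B + p * c₁)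
  rearrange = solve-∀

S-pascal : ∀ n r → S (suc n) (suc r) ≡ S n (suc r) + (- + 2) * S n r
S-pascal n r
  rewrite S≡truncatedBinomial (suc n) (suc r) | S≡truncatedBinomial n (suc r) | S≡truncatedBinomial n r
  = truncatedBinomial-pascal (- + 2) n r

S-0 : ∀ r → S 0 r ≡ + 1
S-0 r = trans (S≡truncatedBinomial 0 r) (truncatedBinomial-0 (- + 2) r)

[-1]^n-bounds : ∀ n → - + 1 ≤ (- + 1) ^ n × (- + 1) ^ n ≤ + 1
[-1]^n-bounds zero = -≤+ , ≤-refl
[-1]^n-bounds (suc n) rewrite -1*i≡-i ((- + 1) ^ n) with [-1]^n-bounds n
... | lower , upper = neg-mono-≤ upper , neg-mono-≤ lower

[-1]^suc-n≡ : ∀ n → (- + 1) ^ suc n ≡ (- + 1) ^ n + (- + 2) * (- + 1) ^ n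
[-1]^suc-n≡ n = trans (-1*i≡-i ((- + 1) ^ n)) (negate ((- + 1) ^ n))
  where
  negate : ∀ s → - s ≡ s + (- + 2) * s
  negate = solve-∀

+-*[-2]-mono : ∀ {z z′ y y′} → z ≤ z′ → y′ ≤ y → z + (- + 2) * y ≤ z′ + (- + 2) * y′
+-*[-2]-mono z≤z′ y′≤y = +-mono-≤ z≤z′ (*-monoˡ-≤-nonPos (- + 2) y′≤y)

S-even-lower : ∀ n q → (- + 1) ^ n ≤ S n (q ℕ.* 2)
S-odd-upper  : ∀ n q → S n (suc (q ℕ.* 2)) ≤ (- + 1) ^ n

S-even-lower n       zero    = proj₂ ([-1]^n-bounds n)
S-even-lower zero    (suc q) = ≤-reflexive (sym (S-0 (suc q ℕ.* 2)))
S-even-lower (suc n) (suc q) = begin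
  (- + 1) ^ suc n
    ≡⟨ [-1]^suc-n≡ n ⟩
  (- + 1) ^ n + (- + 2) * (- + 1) ^ n
    ≤⟨ +-*[-2]-mono (S-even-lower n (suc q)) (S-odd-upper n q) ⟩
  S n (suc q ℕ.* 2) + (- + 2) * S n (suc (q ℕ.* 2))
    ≡⟨ sym (S-pascal n (suc (q ℕ.* 2))) ⟩
  S (suc n) (suc q ℕ.* 2) ∎
  where open ≤-Reasoning

S-odd-upper zero    q = ≤-reflexive (S-0 (suc (q ℕ.* 2)))
S-odd-upper (suc n) q = begin
  S (suc n) (suc (q ℕ.* 2))
    ≡⟨ S-pascal n (q ℕ.* 2) ⟩
  S n (suc (q ℕ.* 2)) + (- + 2) * S n (q ℕ.* 2)
    ≤⟨ +-*[-2]-mono (S-odd-upper n q) (S-even-lower n q) ⟩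
  (- + 1) ^ n + (- + 2) * (- + 1) ^ n
    ≡⟨ sym ([-1]^suc-n≡ n) ⟩
  (- + 1) ^ suc n ∎
  where open ≤-Reasoning

¬2∣⇒odd : ∀ r → ¬ (2 ∣ r) → ∃[ q ] r ≡ suc (q ℕ.* 2)
¬2∣⇒odd zero          ¬2∣r = ⊥-elim (¬2∣r (2 ∣0))
¬2∣⇒odd (suc zero)    _    = 0 , refl
¬2∣⇒odd (suc (suc r)) ¬2∣r with ¬2∣⇒odd r (¬2∣r ∘ ∣m∣n⇒∣m+n ∣-refl)
... | q , refl = suc q , refl

lemma3p1 : (N r : ℕ) →
    ((2 ∣ r) → (- + 1) ^ N ≤ S N r) ×
    (¬ (2 ∣ r) → S N r ≤ (- + 1) ^ N)
lemma3p1 N r = even , odd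
  where
  even : 2 ∣ r → (- + 1) ^ N ≤ S N r
  even (divides q refl) = S-even-lower N q
  odd : ¬ (2 ∣ r) → S N r ≤ (- + 1) ^ N
  odd ¬2∣r with ¬2∣⇒odd r ¬2∣r
  ... | q , refl = S-odd-upper N q
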